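{- Let $m\ge1$, $C=\{1,\dots,2m\}$ and $\pi=(1\,2)(3\,4)\cdots(2m-1\;2m)$. Let $P$ be a combinatorial map on $C$ with edge involution $\rho=P\pi P^{ -1}$. Let $C=C_1\sqcup C_2$ fix the knot $\mu=[\pi;\rho]$, and let $\varepsilon=[\pi;\delta]$ be the edge structuring knot. - If $\mu$ is (fully) normalized, then $\varepsilon$ is partially normalized. - If $\varepsilon$ is (fully) normalized, then $\mu$ is partially normalized.
   Context: Permutations act on the right: $a^\sigma$ is the image of $a$ under $\sigma$. Products are read left to right, $a^{\sigma\tau}=(a^\sigma)^\tau$, and conjugation is $x^y=y^{ -1}xy$. A (normalized) combinatorial map on $C$ is any permutation $P$ of $C$ (the vertex rotation), with face rotation $Q=P\pi$ and edge involution $\rho=PQ^{ -1}=P\pi P^{ -1}$. Fixing a combinatorial knot means choosing a partition $C=C_1\sqcup C_2$ such that both $\pi$ and $\rho$ map $C_1$ bijectively onto $C_2$. The knot $\mu=[\pi;\rho]$ is the permutation with $a^\mu=a^\pi$ for $a\in C_1$ and $a^\mu=a^\rho$ for $a\in C_2$. Cycle edges: let $\pi_2$ be the product of those transpositions $(x\;y)$ of $\pi$ for which $x$ and $x^{P^{ -1}}$ lie in different parts. Then $P\pi_2$ maps $C_1$ to $C_1$ and $C_2$ to $C_2$. Let $\gamma_1$ be the permutation of $C$ with $a^{\gamma_1}=a^{P\pi_2}$ for $a\in C_1$ and $a^{\gamma_1}=a$ for $a\in C_2$. Let $\delta=\pi^{\gamma_1}=\gamma_1^{ -1}\pi\gamma_1$.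 The edge structuring knot is $\varepsilon=[\pi;\delta]$, defined with the same partition: $a^\varepsilon=a^\pi$ for $a\in C_1$ and $a^\varepsilon=a^\delta$ for $a\in C_2$ (note $\delta$ maps $C_2$ into $C_1$). A knot $\kappa=[\pi;\sigma]$ with respect to the partition $(C_1,C_2)$ is (fully) normalized if both of the following hold: - every orbit of $\kappa$ is a cycle $(l\;l{+}1\;\dots\;l{+}2r{ - }1)$ of consecutive integers; - the first element $l$ of each orbit lies in $C_1$, so the step $l\mapsto l+1$ is a $\pi$-step. A knot $\kappa$ is partially normalized if either $(2i-1)^\kappa=2i$ for all $i$, or $(2i)^\kappa=2i-1$ for all $i$, i.e. all $\pi$-transpositions are traversed in the same direction. -}

module Defs where

open import Data.Nat using (ℕ; zero; suc; _+_; _*_; _<_; _≤_; _<ᵇ_)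
open import Data.Fin using (Fin; zero; suc; toℕ; combine; remQuot)
open import Data.Fin.Permutation using (Permutation′; _⟨$⟩ʳ_; _⟨$⟩ˡ_)
open import Data.Bool using (Bool; true; false; if_then_else_; _xor_)
open import Data.Product using (Σ; ∃; _×_; _,_; proj₁; proj₂)
open import Data.Sum using (_⊎_)
open import Relation.Binary.PropositionalEquality using (_≡_)

Dart : ℕ → Set
Dart m = Fin (m * 2)

flip2 : Fin 2 → Fin 2
flip2 zero = suc zero
flip2 (suc zero) = zero

module _ (m : ℕ) where

  -- Conventions (0-indexed): the dart set C = {1,…,2m} is modelled as Fin (m * 2);
  -- the paper's dart k corresponds to the Fin element with toℕ = k - 1.
  -- So the paper's 2i-1 and 2i (i = 1..m) are  combine i 0  and  combine i 1
  -- (values 2i' and 2i'+1 for i' = i-1 : Fin m).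


  odd₁ : Fin m → Dart m
  odd₁ i = combine i zero

  even₁ : Fin m → Dart m
  even₁ i = combine i (suc zero)


  πᶜ : Dart m → Dart m
  πᶜ a = combine {m} (proj₁ (remQuot {m} 2 a)) (flip2 (proj₂ (remQuot {m} 2 a)))

  -- Right action: a^P = P ⟨$⟩ʳ a, a^{P⁻¹} = P ⟨$⟩ˡ a.
  -- A partition C = C₁ ⊔ C₂ is given by a Boolean predicate: inC₁ a ≡ true iff a ∈ C₁
  -- (and a ∈ C₂ iff inC₁ a ≡ false).

  -- edge involution ρ = P π P⁻¹ :  a^ρ = ((a^P)^π)^{P⁻¹}
  ρᶜ : Permutation′ (m * 2) → Dart m → Dart m
  ρᶜ P a = P ⟨$⟩ˡ (πᶜ (P ⟨$⟩ʳ a))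

  MapsC₁OntoC₂ : (Dart m → Bool) → (Dart m → Dart m) → Set
  MapsC₁OntoC₂ inC₁ f =
    (∀ a → inC₁ a ≡ true → inC₁ (f a) ≡ false)
    × (∀ b → inC₁ b ≡ false → Σ _ λ a → inC₁ a ≡ true × f a ≡ b)
    × (∀ a a′ → inC₁ a ≡ true → inC₁ a′ ≡ true → f a ≡ f a′ → a ≡ a′)

  FixesKnot : Permutation′ (m * 2) → (Dart m → Bool) → Set
  FixesKnot P inC₁ = MapsC₁OntoC₂ inC₁ πᶜ × MapsC₁OntoC₂ inC₁ (ρᶜ P)

  knot : (Dart m → Bool) → (Dart m → Dart m) → Dart m → Dart m
  knot inC₁ σ a = if inC₁ a then πᶜ a else σ a

  μᶜ : Permutation′ (m * 2) → (Dart m → Bool) → Dart m → Dart m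
  μᶜ P inC₁ = knot inC₁ (ρᶜ P)

  -- π₂ : product of the transpositions (x y) of π with x, x^{P⁻¹} in different parts
  -- (pointwise: x ↦ x^π if x and x^{P⁻¹} lie in different parts, else x ↦ x;
  --  under FixesKnot the condition holds for x iff it holds for y = x^π).
  π₂ᶜ : Permutation′ (m * 2) → (Dart m → Bool) → Dart m → Dart m
  π₂ᶜ P inC₁ x = if inC₁ x xor inC₁ (P ⟨$⟩ˡ x) then πᶜ x else x

  γ₁ᶜ : Permutation′ (m * 2) → (Dart m → Bool) → Dart m → Dart m
  γ₁ᶜ P inC₁ a = if inC₁ a then π₂ᶜ P inC₁ (P ⟨$⟩ʳ a) else a

  -- γ₁⁻¹ : a ↦ a^{π₂ P⁻¹} on C₁ (π₂ is an involution), identity on C₂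
  γ₁⁻¹ᶜ : Permutation′ (m * 2) → (Dart m → Bool) → Dart m → Dart m
  γ₁⁻¹ᶜ P inC₁ a = if inC₁ a then P ⟨$⟩ˡ (π₂ᶜ P inC₁ a) else a

  -- δ = π^{γ₁} = γ₁⁻¹ π γ₁ :  a^δ = ((a^{γ₁⁻¹})^π)^{γ₁}
  δᶜ : Permutation′ (m * 2) → (Dart m → Bool) → Dart m → Dart m
  δᶜ P inC₁ a = γ₁ᶜ P inC₁ (πᶜ (γ₁⁻¹ᶜ P inC₁ a))

  εᶜ : Permutation′ (m * 2) → (Dart m → Bool) → Dart m → Dart m
  εᶜ P inC₁ = knot inC₁ (δᶜ P inC₁)

  OrbitIsNormalCycle : (Dart m → Bool) → (Dart m → Dart m) → Dart m → Set
  OrbitIsNormalCycle inC₁ κ a =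
    Σ (Dart m) λ l → Σ ℕ λ r →
      1 ≤ r × toℕ l + 2 * r ≤ m * 2 × inC₁ l ≡ true
      × toℕ l ≤ toℕ a × toℕ a < toℕ l + 2 * r
      × (∀ (b : Dart m) → toℕ l ≤ toℕ b → toℕ b < toℕ l + 2 * r →
           toℕ (κ b) ≡ (if suc (toℕ b) <ᵇ toℕ l + 2 * r
                         then suc (toℕ b) else toℕ l))

  FullyNormalized : (Dart m → Bool) → (Dart m → Dart m) → Set
  FullyNormalized inC₁ κ = ∀ (a : Dart m) → OrbitIsNormalCycle inC₁ κ a

  PartiallyNormalized : (Dart m → Dart m) → Set
  PartiallyNormalized κ =
    (∀ (i : Fin m) → κ (odd₁ i) ≡ even₁ i) ⊎ (∀ (i : Fin m) → κ (even₁ i) ≡ odd₁ i)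

module Submission where

-- Proof idea.  Both halves of the theorem are instances of one statement about
-- an arbitrary knot κ = [π; σ] whose second component σ maps C₂ into C₁:
--
--   if κ is fully normalized, then every dart 2i-1 lies in C₁.          (★)
--
-- Indeed κ alternates between the parts (π sends C₁ to C₂, σ sends C₂ to C₁),
-- so along a normal cycle (l l+1 … l+2r-1) with l ∈ C₁ the darts l, l+2, l+4, …
-- lie in C₁.  Moreover l^κ = l^π = l+1 forces l to be an odd dart 2q-1, hence
-- every odd dart of the cycle sits at an even offset from l.  Given (★), any
-- other knot [π; σ'] sends 2i-1 ∈ C₁ to (2i-1)^π = 2i, so it is partially
-- normalized.  The theorem follows by applying (★) with σ = ρ (normalized μ)
-- and with σ = δ (normalized ε); it remains to check that ρ and δ map C₂ into
-- C₁, which uses that π and ρ are involutions and that Pπ₂ preserves C₁.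

open import Defs
open import Data.Nat using (ℕ; suc; _*_)
open import Data.Bool using (Bool)
open import Data.Product using (_×_)
open import Data.Fin.Permutation using (Permutation′)

open import Data.Nat using (_+_; _∸_; _<_; _≤_; _<ᵇ_)
open import Data.Nat.Properties
open import Data.Fin using (Fin; toℕ; combine; remQuot) renaming (zero to fzero; suc to fsuc)
open import Data.Fin.Properties using (remQuot-combine; combine-remQuot; toℕ-combine; toℕ-injective)
open import Data.Fin.Permutation using (_⟨$⟩ʳ_; _⟨$⟩ˡ_; inverseˡ; inverseʳ)
open import Data.Bool using (true; false; not; if_then_else_)
open import Data.Bool.Properties using (T-≡; not-involutive)
open import Data.Product using (Σ; _,_; proj₁; proj₂; uncurry)
open import Data.Sum using (_⊎_; inj₁; inj₂)
open import Function.Bundles using (Equivalence)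
open import Relation.Nullary using (contradiction)
open import Relation.Binary.PropositionalEquality

if-<ᵇ-then : ∀ {a b : ℕ} (x y : ℕ) → a < b → (if a <ᵇ b then x else y) ≡ x
if-<ᵇ-then {a} {b} x y a<b =
  cong (λ c → if c then x else y) (Equivalence.to T-≡ (<⇒<ᵇ a<b))

module _ (m : ℕ) where

  toℕ-odd₁ : ∀ i → toℕ (odd₁ m i) ≡ 2 * toℕ i
  toℕ-odd₁ i = trans (toℕ-combine i fzero) (+-identityʳ _)

  toℕ-even₁ : ∀ i → toℕ (even₁ m i) ≡ suc (2 * toℕ i)
  toℕ-even₁ i = trans (toℕ-combine i (fsuc fzero)) (+-comm _ 1)

  dart-cases : ∀ (a : Dart m) → Σ (Fin m) λ i → a ≡ odd₁ m i ⊎ a ≡ even₁ m i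
  dart-cases a with remQuot {m} 2 a in split
  ... | i , fzero      = i , inj₁ (trans (sym (combine-remQuot {m} 2 a)) (cong (uncurry combine) split))
  ... | i , fsuc fzero = i , inj₂ (trans (sym (combine-remQuot {m} 2 a)) (cong (uncurry combine) split))

  π-combine : ∀ (i : Fin m) r → πᶜ m (combine i r) ≡ combine i (flip2 r)
  π-combine i r =
    cong (λ p → combine {m} {2} (proj₁ p) (flip2 (proj₂ p)))
         (remQuot-combine {m} {2} i r)

  π-odd₁ : ∀ i → πᶜ m (odd₁ m i) ≡ even₁ m i
  π-odd₁ i = π-combine i fzero

  π-even₁ : ∀ i → πᶜ m (even₁ m i) ≡ odd₁ m i
  π-even₁ i = π-combine i (fsuc fzero)

  π-involutive : ∀ a → πᶜ m (πᶜ m a) ≡ a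
  π-involutive a with dart-cases a
  ... | i , inj₁ refl = trans (cong (πᶜ m) (π-odd₁ i)) (π-even₁ i)
  ... | i , inj₂ refl = trans (cong (πᶜ m) (π-even₁ i)) (π-odd₁ i)

  -- If π moves a dart one step up, that dart is odd: 2i^π = 2i-1 is a step down.
  π-ascending⇒odd : ∀ a → toℕ (πᶜ m a) ≡ suc (toℕ a) → Σ (Fin m) λ i → a ≡ odd₁ m i
  π-ascending⇒odd a up with dart-cases a
  ... | i , inj₁ a≡ = i , a≡
  ... | i , inj₂ refl = contradiction down (<⇒≢ (<-trans (n<1+n _) (n<1+n _)))
    where
    down : 2 * toℕ i ≡ suc (suc (2 * toℕ i))
    down = begin
      2 * toℕ i                ≡⟨ sym (toℕ-odd₁ i) ⟩
      toℕ (odd₁ m i)           ≡⟨ cong toℕ (sym (π-even₁ i)) ⟩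
      toℕ (πᶜ m (even₁ m i))   ≡⟨ up ⟩
      suc (toℕ (even₁ m i))    ≡⟨ cong suc (toℕ-even₁ i) ⟩
      suc (suc (2 * toℕ i))    ∎
      where open ≡-Reasoning

  ρ-involutive : ∀ P a → ρᶜ m P (ρᶜ m P a) ≡ a
  ρ-involutive P a = begin
    P ⟨$⟩ˡ πᶜ m (P ⟨$⟩ʳ (P ⟨$⟩ˡ πᶜ m (P ⟨$⟩ʳ a))) ≡⟨ cong (λ z → P ⟨$⟩ˡ πᶜ m z) (inverseʳ P) ⟩
    P ⟨$⟩ˡ πᶜ m (πᶜ m (P ⟨$⟩ʳ a))                ≡⟨ cong (P ⟨$⟩ˡ_) (π-involutive (P ⟨$⟩ʳ a)) ⟩
    P ⟨$⟩ˡ (P ⟨$⟩ʳ a)                            ≡⟨ inverseˡ P ⟩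
    a                                            ∎
    where open ≡-Reasoning

  involution-C₂→C₁ : ∀ inC₁ f → (∀ a → f (f a) ≡ a) → MapsC₁OntoC₂ m inC₁ f →
                     ∀ b → inC₁ b ≡ false → inC₁ (f b) ≡ true
  involution-C₂→C₁ inC₁ f f-inv (_ , onto , _) b b∈C₂ with onto b b∈C₂
  ... | a , a∈C₁ , refl = subst (λ x → inC₁ x ≡ true) (sym (f-inv a)) a∈C₁

  module _ (P : Permutation′ (m * 2)) (inC₁ : Dart m → Bool)
           (π-C₂→C₁ : ∀ b → inC₁ b ≡ false → inC₁ (πᶜ m b) ≡ true) where

    -- π₂ corrects x into C₁ whenever x^{P⁻¹} ∈ C₁: this is why Pπ₂ preserves C₁.
    π₂-into-C₁ : ∀ x → inC₁ (P ⟨$⟩ˡ x) ≡ true → inC₁ (π₂ᶜ m P inC₁ x) ≡ true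
    π₂-into-C₁ x x′∈C₁ rewrite x′∈C₁ with inC₁ x in x∈
    ... | true  = x∈
    ... | false = π-C₂→C₁ x x∈

    γ₁-C₁→C₁ : ∀ c → inC₁ c ≡ true → inC₁ (γ₁ᶜ m P inC₁ c) ≡ true
    γ₁-C₁→C₁ c c∈C₁ rewrite c∈C₁ =
      π₂-into-C₁ (P ⟨$⟩ʳ c) (subst (λ z → inC₁ z ≡ true) (sym (inverseˡ P)) c∈C₁)

    -- On C₂ we have γ₁⁻¹ = id, so b^δ = (b^π)^{γ₁} ∈ C₁.
    δ-C₂→C₁ : ∀ b → inC₁ b ≡ false → inC₁ (δᶜ m P inC₁ b) ≡ true
    δ-C₂→C₁ b b∈C₂ rewrite b∈C₂ = γ₁-C₁→C₁ (πᶜ m b) (π-C₂→C₁ b b∈C₂)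

  module _ (inC₁ : Dart m → Bool) where

    odd-in-C₁⇒partially-normalized : ∀ σ → (∀ i → inC₁ (odd₁ m i) ≡ true) →
                                     PartiallyNormalized m (knot m inC₁ σ)
    odd-in-C₁⇒partially-normalized σ odd∈C₁ = inj₁ λ i → begin
      knot m inC₁ σ (odd₁ m i) ≡⟨ cong (λ c → if c then _ else _) (odd∈C₁ i) ⟩
      πᶜ m (odd₁ m i)          ≡⟨ π-odd₁ i ⟩
      even₁ m i                ∎
      where open ≡-Reasoning

    module _ (σ : Dart m → Dart m)
             (π-C₁→C₂ : ∀ a → inC₁ a ≡ true → inC₁ (πᶜ m a) ≡ false)
             (σ-C₂→C₁ : ∀ b → inC₁ b ≡ false → inC₁ (σ b) ≡ true) where

      κ : Dart m → Dart m
      κ = knot m inC₁ σ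

      κ-alternates : ∀ b → inC₁ (κ b) ≡ not (inC₁ b)
      κ-alternates b with inC₁ b in b∈
      ... | true  = π-C₁→C₂ b b∈
      ... | false = σ-C₂→C₁ b b∈

      κ²-same-part : ∀ b → inC₁ (κ (κ b)) ≡ inC₁ b
      κ²-same-part b = begin
        inC₁ (κ (κ b))        ≡⟨ κ-alternates (κ b) ⟩
        not (inC₁ (κ b))      ≡⟨ cong not (κ-alternates b) ⟩
        not (not (inC₁ b))    ≡⟨ not-involutive _ ⟩
        inC₁ b                ∎
        where open ≡-Reasoning

      module NormalCycle (l : Dart m) (r : ℕ) (l∈C₁ : inC₁ l ≡ true)
        (step : ∀ (b : Dart m) → toℕ l ≤ toℕ b → toℕ b < toℕ l + 2 * r →
                  toℕ (κ b) ≡ (if suc (toℕ b) <ᵇ toℕ l + 2 * r then suc (toℕ b) else toℕ l)) where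

        L : ℕ
        L = toℕ l

        ascends : ∀ b → L ≤ toℕ b → suc (toℕ b) < L + 2 * r → toℕ (κ b) ≡ suc (toℕ b)
        ascends b L≤b b+1< =
          trans (step b L≤b (<-trans (n<1+n _) b+1<)) (if-<ᵇ-then _ _ b+1<)

        even-offsets-in-C₁ : ∀ j → j < r → Σ (Dart m) λ d → toℕ d ≡ L + 2 * j × inC₁ d ≡ true
        even-offsets-in-C₁ 0 _ = l , sym (+-identityʳ L) , l∈C₁
        even-offsets-in-C₁ (suc j) j+1<r with even-offsets-in-C₁ j (<-trans (n<1+n j) j+1<r)
        ... | d , d≡ , d∈C₁ = κ (κ d) , κ²d≡ , trans (κ²-same-part d) d∈C₁
          where
          offset : L + 2 * suc j ≡ suc (suc (toℕ d))
          offset = trans (cong (L +_) (*-suc 2 j))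
                     (trans (+-suc L _) (cong suc (trans (+-suc L _) (cong suc (sym d≡)))))
          d+2< : suc (suc (toℕ d)) < L + 2 * r
          d+2< = subst (_< L + 2 * r) offset (+-monoʳ-< L (*-monoʳ-< 2 j+1<r))
          L≤d : L ≤ toℕ d
          L≤d = subst (L ≤_) (sym d≡) (m≤m+n L _)
          κd≡ : toℕ (κ d) ≡ suc (toℕ d)
          κd≡ = ascends d L≤d (<-trans (n<1+n _) d+2<)
          κ²d≡ : toℕ (κ (κ d)) ≡ L + 2 * suc j
          κ²d≡ = begin
            toℕ (κ (κ d))        ≡⟨ ascends (κ d) (subst (L ≤_) (sym κd≡) (m≤n⇒m≤1+n L≤d))
                                                  (subst (λ x → suc x < L + 2 * r) (sym κd≡) d+2<) ⟩
            suc (toℕ (κ d))      ≡⟨ cong suc κd≡ ⟩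
            suc (suc (toℕ d))    ≡⟨ sym offset ⟩
            L + 2 * suc j        ∎
            where open ≡-Reasoning

        -- Since l^π = l^κ = l+1, the cycle starts at an odd dart.
        starts-odd : 1 ≤ r → Σ (Fin m) λ q → l ≡ odd₁ m q
        starts-odd 1≤r = π-ascending⇒odd l (begin
          toℕ (πᶜ m l)    ≡⟨ cong toℕ (sym (cong (λ c → if c then _ else _) l∈C₁)) ⟩
          toℕ (κ l)       ≡⟨ ascends l ≤-refl L+1< ⟩
          suc L           ∎)
          where
          open ≡-Reasoning
          L+1< : suc L < L + 2 * r
          L+1< = subst (_≤ L + 2 * r) (+-comm L 2) (+-monoʳ-≤ L (*-monoʳ-≤ 2 1≤r))

        even-offset⇒in-C₁ : ∀ a j → toℕ a ≡ L + 2 * j → j < r → inC₁ a ≡ true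
        even-offset⇒in-C₁ a j a≡ j<r with even-offsets-in-C₁ j j<r
        ... | d , d≡ , d∈C₁ = subst (λ x → inC₁ x ≡ true) (toℕ-injective (trans d≡ (sym a≡))) d∈C₁

        -- As l = 2q-1, every odd dart 2i-1 of the cycle is at the even offset 2(i-q).
        odd-in-C₁ : 1 ≤ r → ∀ i → L ≤ toℕ (odd₁ m i) → toℕ (odd₁ m i) < L + 2 * r →
                    inC₁ (odd₁ m i) ≡ true
        odd-in-C₁ 1≤r i L≤a a< with starts-odd 1≤r
        ... | q , l≡ = even-offset⇒in-C₁ (odd₁ m i) j a≡ j<r
          where
          L≡ : L ≡ 2 * toℕ q
          L≡ = trans (cong toℕ l≡) (toℕ-odd₁ q)
          q≤i : toℕ q ≤ toℕ i
          q≤i = *-cancelˡ-≤ 2 (subst₂ _≤_ L≡ (toℕ-odd₁ i) L≤a)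
          j : ℕ
          j = toℕ i ∸ toℕ q
          a≡ : toℕ (odd₁ m i) ≡ L + 2 * j
          a≡ = begin
            toℕ (odd₁ m i)          ≡⟨ toℕ-odd₁ i ⟩
            2 * toℕ i               ≡⟨ cong (2 *_) (sym (m+[n∸m]≡n q≤i)) ⟩
            2 * (toℕ q + j)         ≡⟨ *-distribˡ-+ 2 (toℕ q) j ⟩
            2 * toℕ q + 2 * j       ≡⟨ cong (_+ 2 * j) (sym L≡) ⟩
            L + 2 * j               ∎
            where open ≡-Reasoning
          j<r : j < r
          j<r = *-cancelˡ-< 2 j r (+-cancelˡ-< L (2 * j) (2 * r) (subst (_< L + 2 * r) a≡ a<))

      normalized⇒odd-in-C₁ : FullyNormalized m inC₁ κ → ∀ i → inC₁ (odd₁ m i) ≡ true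
      normalized⇒odd-in-C₁ FN i with FN (odd₁ m i)
      ... | l , r , 1≤r , _ , l∈C₁ , L≤a , a< , step =
        NormalCycle.odd-in-C₁ l r l∈C₁ step 1≤r i L≤a a<

theorem14 : (k : ℕ) → (P : Permutation′ (suc k * 2)) → (inC₁ : Dart (suc k) → Bool) →
    FixesKnot (suc k) P inC₁ →
    (FullyNormalized (suc k) inC₁ (μᶜ (suc k) P inC₁) → PartiallyNormalized (suc k) (εᶜ (suc k) P inC₁))
    × (FullyNormalized (suc k) inC₁ (εᶜ (suc k) P inC₁) → PartiallyNormalized (suc k) (μᶜ (suc k) P inC₁))
theorem14 k P inC₁ (π-knot , ρ-knot) = μ-normalized , ε-normalized
  where
  C₂→C₁ : (Dart (suc k) → Dart (suc k)) → Set
  C₂→C₁ f = ∀ b → inC₁ b ≡ false → inC₁ (f b) ≡ true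

  π-into-C₁ : C₂→C₁ (πᶜ (suc k))
  π-into-C₁ = involution-C₂→C₁ (suc k) inC₁ (πᶜ (suc k)) (π-involutive (suc k)) π-knot

  ρ-into-C₁ : C₂→C₁ (ρᶜ (suc k) P)
  ρ-into-C₁ = involution-C₂→C₁ (suc k) inC₁ (ρᶜ (suc k) P) (ρ-involutive (suc k) P) ρ-knot

  μ-normalized : FullyNormalized (suc k) inC₁ (μᶜ (suc k) P inC₁) → PartiallyNormalized (suc k) (εᶜ (suc k) P inC₁)
  μ-normalized FN = odd-in-C₁⇒partially-normalized (suc k) inC₁ (δᶜ (suc k) P inC₁)
    (normalized⇒odd-in-C₁ (suc k) inC₁ (ρᶜ (suc k) P) (proj₁ π-knot) ρ-into-C₁ FN)

  ε-normalized : FullyNormalized (suc k) inC₁ (εᶜ (suc k) P inC₁) → PartiallyNormalized (suc k) (μᶜ (suc k) P inC₁)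
  ε-normalized FN = odd-in-C₁⇒partially-normalized (suc k) inC₁ (ρᶜ (suc k) P)
    (normalized⇒odd-in-C₁ (suc k) inC₁ (δᶜ (suc k) P inC₁) (proj₁ π-knot) (δ-C₂→C₁ (suc k) P inC₁ π-into-C₁) FN)
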